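{- Let $G=(V,E)$ be a connected bipartite graph of order $n=r+s\ge 4$ with stable sets $U$ and $W$, $V=U\cup W$, where $|U|=r$, $|W|=s$ and $3\le r<s$. Then $\lambda(\overline{G})=\lambda(G)+1$ if and only if the following three conditions hold: (i) $W$ contains no pair of twins (in $G$); (ii) there exists a vertex $w\in W$ such that $N(w)=U$; (iii) for every vertex $u\in U$, the graph $G-u$ has at least two pairs of twins in $W$.
   Context: All graphs are simple and finite. $N(x)$ denotes the open neighborhood of $x$. A set $S\subseteq V$ is distinguishing if $N(x)\cap S\neq N(y)\cap S$ for all distinct $x,y\in V\setminus S$; dominating if every vertex not in $S$ has a neighbor in $S$; a locating-dominating set is a set that is both distinguishing and dominating. $\lambda(G)$ is the minimum cardinality of a locating-dominating set of $G$. $\overline{G}$ is the complement of $G$. Two distinct vertices $x,y$ of a graph are twins if $N(x)=N(y)$ or $N(x)\cup\{x\}=N(y)\cup\{y\}$ (neighborhoods taken in that graph). $G-u$ is the graph obtained by deleting vertex $u$. -}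

module Defs where

open import Data.Nat using (ℕ; _≤_; _<_; _+_)
open import Data.Fin using (Fin; _≟_)
import Data.Fin as F
open import Data.Fin.Subset using (Subset; _∈_; _∉_; ∣_∣; ∁)
open import Data.Bool using (Bool; true; false; not; if_then_else_)
open import Data.Product using (Σ; ∃; _×_; _,_)
open import Data.Sum using (_⊎_)
open import Relation.Nullary using (¬_)
open import Relation.Nullary.Decidable using (⌊_⌋)
open import Relation.Binary.PropositionalEquality using (_≡_; _≢_)

Adj : ℕ → Set
Adj n = Fin n → Fin n → Bool

IsSimple : ∀ {n} → Adj n → Set
IsSimple {n} G = (∀ (x y : Fin n) → G x y ≡ G y x) × (∀ (x : Fin n) → G x x ≡ false)

compl : ∀ {n} → Adj n → Adj n
compl G x y = if ⌊ x ≟ y ⌋ then false else not (G x y)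

data Reach {n} (G : Adj n) : Fin n → Fin n → Set where
  here : ∀ {x} → Reach G x x
  step : ∀ {x y z} → G x y ≡ true → Reach G y z → Reach G x z

Connected : ∀ {n} → Adj n → Set
Connected {n} G = ∀ (x y : Fin n) → Reach G x y

Stable : ∀ {n} → Adj n → Subset n → Set
Stable {n} G S = ∀ (x y : Fin n) → x ∈ S → y ∈ S → G x y ≡ false

SameTrace : ∀ {n} → Adj n → Subset n → Fin n → Fin n → Set
SameTrace {n} G S x y = ∀ (z : Fin n) → z ∈ S → G x z ≡ G y z

Distinguishing : ∀ {n} → Adj n → Subset n → Set
Distinguishing {n} G S =
  ∀ (x y : Fin n) → x ∉ S → y ∉ S → x ≢ y → ¬ SameTrace G S x y

Dominating : ∀ {n} → Adj n → Subset n → Set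
Dominating {n} G S = ∀ (x : Fin n) → x ∉ S → ∃ λ (z : Fin n) → z ∈ S × G x z ≡ true

LocatingDominating : ∀ {n} → Adj n → Subset n → Set
LocatingDominating G S = Distinguishing G S × Dominating G S

IsLambda : ∀ {n} → Adj n → ℕ → Set
IsLambda {n} G k =
  (∃ λ (S : Subset n) → LocatingDominating G S × ∣ S ∣ ≡ k)
  × (∀ (S : Subset n) → LocatingDominating G S → k ≤ ∣ S ∣)

-- Twins in the graph G - D (the induced subgraph on vertices outside D),
-- for vertices x, y not in D.  Neighbourhoods are taken in G - D.
ClosedNbr : ∀ {n} → Adj n → Fin n → Fin n → Set
ClosedNbr G x z = (z ≡ x) ⊎ (G x z ≡ true)

TwinsIn : ∀ {n} → Adj n → Subset n → Fin n → Fin n → Set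
TwinsIn {n} G D x y =
  x ∉ D × y ∉ D × x ≢ y ×
  ( (∀ (z : Fin n) → z ∉ D → G x z ≡ G y z)
  ⊎ (∀ (z : Fin n) → z ∉ D →
       (ClosedNbr G x z → ClosedNbr G y z) × (ClosedNbr G y z → ClosedNbr G x z)) )

Twins : ∀ {n} → Adj n → Fin n → Fin n → Set
Twins {n} G x y = TwinsIn G Data.Fin.Subset.⊥ x y

TwinsMinus : ∀ {n} → Adj n → Fin n → Fin n → Fin n → Set
TwinsMinus G u x y = TwinsIn G (Data.Fin.Subset.⁅ u ⁆) x y

CondI : ∀ {n} → Adj n → Subset n → Set
CondI {n} G W = ∀ (x y : Fin n) → x ∈ W → y ∈ W → ¬ Twins G x y

CondII : ∀ {n} → Adj n → Subset n → Subset n → Set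
CondII {n} G U W = ∃ λ (w : Fin n) → w ∈ W ×
  (∀ (u : Fin n) → (G w u ≡ true → u ∈ U) × (u ∈ U → G w u ≡ true))

CondIII : ∀ {n} → Adj n → Subset n → Subset n → Set
CondIII {n} G U W = ∀ (u : Fin n) → u ∈ U →
  Σ (Fin n) λ x → Σ (Fin n) λ y → Σ (Fin n) λ x' → Σ (Fin n) λ y' →
    x ∈ W × y ∈ W × x' ∈ W × y' ∈ W ×
    x F.< y × x' F.< y' × ¬ (x ≡ x' × y ≡ y') ×
    TwinsMinus G u x y × TwinsMinus G u x' y'

-- A set is distinguishing in G iff it is in the complement Ḡ, and a locating-dominating
-- set S of G fails to dominate Ḡ only at a vertex outside S adjacent to all of S; such a
-- "universal" vertex is unique. Hence λ(Ḡ) = λ(G) + 1 exactly when every distinguishing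
-- set of G with at most λ(G) elements has a universal vertex.
--
-- In the bipartite graph, (i) makes U locating-dominating, so λ(G) ≤ r. The basic tool is
-- the exchange of a vertex x of one side for a neighbour y on the other side: the result
-- has the size of the side, has no universal vertex, and is distinguishing unless two
-- vertices of the other side, both different from y, agree off x.
-- (⇒) The universal vertex of an optimal set S₀ forces S₀ to be a whole side. If e, f ∈ W
-- were twins, one of them, say e, would lie in S₀, forcing S₀ = W, and exchanging e for
-- the universal vertex would contradict the property; so (i) holds, λ(G) ≤ r < s forces
-- S₀ = U, and its universal vertex gives (ii). Exchanging u ∈ U for that vertex, and for
-- the end adjacent to u of a twin pair of G - u if there were only one, yields (iii).
-- (⇐) Let S be distinguishing with |S| ≤ r and K = U ∖ S ≠ ∅. A vertex u ∈ K forces two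
-- vertices of W into S, one from each of the two twin pairs of G - u, and by (i) each
-- further vertex of K forces one more, so |S| > r. Hence S = U, and the vertex of (ii)
-- is universal for it.

module Submission where

open import Defs
open import Data.Nat using (ℕ; zero; suc; _≤_; _<_; _+_; s≤s; z≤n; s≤s⁻¹)
import Data.Nat.Properties as ℕ
open import Data.Bool using (true; false; not)
import Data.Bool as Bool
open import Data.Fin using (Fin; _≟_)
import Data.Fin as F
open import Data.Fin.Properties using (any?; all?; ¬∀⟶∃¬; <-cmp; _<?_)
import Data.Fin.Properties as F
open import Data.Fin.Subset
open import Data.Fin.Subset.Properties
open import Data.Bool.Properties using (not-injective; ¬-not)
open import Data.Vec using (_∷_; []; here; there)
open import Data.Product using (Σ; ∃; _×_; _,_; proj₁; proj₂)
open import Data.Sum using (_⊎_; inj₁; inj₂; [_,_]′)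
open import Data.Empty using (⊥-elim)
open import Function using (_∘_; const)
import Data.Empty as Empty
open import Relation.Nullary using (¬_; Dec; yes; no; contradiction)
open import Relation.Nullary.Decidable using (¬?; _×-dec_; _→-dec_)
open import Relation.Binary using (tri<; tri≈; tri>)
open import Relation.Binary.PropositionalEquality
  using (_≡_; _≢_; refl; sym; trans; cong; cong₂; subst; subst₂; ≢-sym; module ≡-Reasoning)

private variable
  n : ℕ
  p q : Subset n
  x y : Fin n

∣p∣≡∣p∩q∣+∣p∩∁q∣ : (p q : Subset n) → ∣ p ∣ ≡ ∣ p ∩ q ∣ + ∣ p ∩ ∁ q ∣
∣p∣≡∣p∩q∣+∣p∩∁q∣ []          []          = refl
∣p∣≡∣p∩q∣+∣p∩∁q∣ (true ∷ p)  (true ∷ q)  = cong suc (∣p∣≡∣p∩q∣+∣p∩∁q∣ p q)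
∣p∣≡∣p∩q∣+∣p∩∁q∣ (true ∷ p)  (false ∷ q) =
  trans (cong suc (∣p∣≡∣p∩q∣+∣p∩∁q∣ p q)) (sym (ℕ.+-suc _ _))
∣p∣≡∣p∩q∣+∣p∩∁q∣ (false ∷ p) (true ∷ q)  = ∣p∣≡∣p∩q∣+∣p∩∁q∣ p q
∣p∣≡∣p∩q∣+∣p∩∁q∣ (false ∷ p) (false ∷ q) = ∣p∣≡∣p∩q∣+∣p∩∁q∣ p q

∣p∣>0⇒Nonempty : 0 < ∣ p ∣ → Nonempty p
∣p∣>0⇒Nonempty {p = true ∷ p}  _ = F.zero , here
∣p∣>0⇒Nonempty {p = false ∷ p} h with ∣p∣>0⇒Nonempty h
... | x , x∈p = F.suc x , there x∈p

x∈p─q⇒x∉q : x ∈ p ─ q → x ∉ q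
x∈p─q⇒x∉q {x = F.zero}  {p = true ∷ p} {q = false ∷ q} here ()
x∈p─q⇒x∉q {x = F.suc x} {p = _ ∷ p}    {q = _ ∷ q}     (there x∈) (there x∈q) =
  x∈p─q⇒x∉q x∈ x∈q

x∈p-y⇒x≢y : x ∈ p - y → x ≢ y
x∈p-y⇒x≢y x∈ = x∉⁅y⁆⇒x≢y (x∈p─q⇒x∉q x∈)

x∉p⇒∣p∪⁅x⁆∣≡1+∣p∣ : x ∉ p → ∣ p ∪ ⁅ x ⁆ ∣ ≡ suc ∣ p ∣
x∉p⇒∣p∪⁅x⁆∣≡1+∣p∣ {x = F.zero}  {p = true ∷ p}  x∉ = contradiction here x∉
x∉p⇒∣p∪⁅x⁆∣≡1+∣p∣ {x = F.zero}  {p = false ∷ p} x∉ =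
  cong (suc ∘ ∣_∣) (∪-identityʳ p)
x∉p⇒∣p∪⁅x⁆∣≡1+∣p∣ {x = F.suc x} {p = true ∷ p}  x∉ =
  cong suc (x∉p⇒∣p∪⁅x⁆∣≡1+∣p∣ (λ x∈ → x∉ (there x∈)))
x∉p⇒∣p∪⁅x⁆∣≡1+∣p∣ {x = F.suc x} {p = false ∷ p} x∉ =
  x∉p⇒∣p∪⁅x⁆∣≡1+∣p∣ (λ x∈ → x∉ (there x∈))

x∈p⇒∣p∣≡1+∣p-x∣ : x ∈ p → ∣ p ∣ ≡ suc ∣ p - x ∣
x∈p⇒∣p∣≡1+∣p-x∣ {x = F.zero}  {p = true ∷ p}  here       = cong (suc ∘ ∣_∣) (sym (p─⊥≡p p))
x∈p⇒∣p∣≡1+∣p-x∣ {x = F.suc x} {p = true ∷ p}  (there x∈) = cong suc (x∈p⇒∣p∣≡1+∣p-x∣ x∈)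
x∈p⇒∣p∣≡1+∣p-x∣ {x = F.suc x} {p = false ∷ p} (there x∈) = x∈p⇒∣p∣≡1+∣p-x∣ x∈

x∈p⇒∃other : 2 ≤ ∣ p ∣ → x ∈ p → ∃ λ t → t ∈ p × t ≢ x
x∈p⇒∃other {p = p} {x = x} 2≤∣p∣ x∈p =
  let t , t∈p-x = ∣p∣>0⇒Nonempty {p = p - x} (s≤s⁻¹ (subst (2 ≤_) (x∈p⇒∣p∣≡1+∣p-x∣ x∈p) 2≤∣p∣))
  in t , p─q⊆p p ⁅ x ⁆ t∈p-x , x∈p-y⇒x≢y t∈p-x

p⊆r∧x∈r⇒p∪⁅x⁆⊆r : ∀ {r : Subset n} → p ⊆ r → x ∈ r → p ∪ ⁅ x ⁆ ⊆ r
p⊆r∧x∈r⇒p∪⁅x⁆⊆r {p = p} {x = x} p⊆r x∈r t∈ with x∈p∪q⁻ p ⁅ x ⁆ t∈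
... | inj₁ t∈p = p⊆r t∈p
... | inj₂ t∈x = subst (_∈ _) (sym (x∈⁅y⁆⇒x≡y x t∈x)) x∈r

AdjacentToAll : Adj n → Subset n → Fin n → Set
AdjacentToAll {n} G S x = ∀ (z : Fin n) → z ∈ S → G x z ≡ true

-- A vertex outside S that S fails to dominate in the complement.
Universal : Adj n → Subset n → Fin n → Set
Universal G S x = x ∉ S × AdjacentToAll G S x

UniversalUpTo : Adj n → ℕ → Set
UniversalUpTo {n} G k =
  ∀ (S : Subset n) → Distinguishing G S → ∣ S ∣ ≤ k → ∃ (Universal G S)

∉∧∈⇒≢ : ∀ {S : Subset n} {x z} → x ∉ S → z ∈ S → x ≢ z
∉∧∈⇒≢ x∉S z∈S refl = x∉S z∈S

module _ {n : ℕ} (G : Adj n) where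

  private variable
    S T : Subset n
    a b : ℕ

  compl-≢ : ∀ {x z : Fin n} → x ≢ z → compl G x z ≡ not (G x z)
  compl-≢ {x} {z} x≢z with x ≟ z
  ... | yes x≡z = contradiction x≡z x≢z
  ... | no _    = refl

  sameTrace-compl : ∀ {x y} → x ∉ S → y ∉ S → SameTrace G S x y → SameTrace (compl G) S x y
  sameTrace-compl {S} {x} {y} x∉S y∉S same z z∈S = begin
    compl G x z   ≡⟨ compl-≢ (∉∧∈⇒≢ x∉S z∈S) ⟩
    not (G x z)   ≡⟨ cong not (same z z∈S) ⟩
    not (G y z)   ≡⟨ compl-≢ (∉∧∈⇒≢ y∉S z∈S) ⟨
    compl G y z   ∎
    where open ≡-Reasoning

  sameTrace-compl⁻ : ∀ {x y} → x ∉ S → y ∉ S → SameTrace (compl G) S x y → SameTrace G S x y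
  sameTrace-compl⁻ {S} {x} {y} x∉S y∉S same z z∈S = not-injective (begin
    not (G x z)   ≡⟨ compl-≢ (∉∧∈⇒≢ x∉S z∈S) ⟨
    compl G x z   ≡⟨ same z z∈S ⟩
    compl G y z   ≡⟨ compl-≢ (∉∧∈⇒≢ y∉S z∈S) ⟩
    not (G y z)   ∎)
    where open ≡-Reasoning

  distinguishing-compl : Distinguishing G S → Distinguishing (compl G) S
  distinguishing-compl dist x y x∉S y∉S x≢y same =
    dist x y x∉S y∉S x≢y (sameTrace-compl⁻ x∉S y∉S same)

  distinguishing-compl⁻ : Distinguishing (compl G) S → Distinguishing G S
  distinguishing-compl⁻ dist x y x∉S y∉S x≢y same =
    dist x y x∉S y∉S x≢y (sameTrace-compl x∉S y∉S same)

  distinguishing-⊆ : S ⊆ T → Distinguishing G S → Distinguishing G T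
  distinguishing-⊆ S⊆T dist x y x∉T y∉T x≢y same =
    dist x y (x∉T ∘ S⊆T) (y∉T ∘ S⊆T) x≢y (λ z z∈S → same z (S⊆T z∈S))

  adjacentToAll? : ∀ S x → Dec (AdjacentToAll G S x)
  adjacentToAll? S x = all? (λ z → z ∈? S →-dec G x z Bool.≟ true)

  universal? : ∀ S x → Dec (Universal G S x)
  universal? S x = ¬? (x ∈? S) ×-dec adjacentToAll? S x

  ¬adjacentToAll⇒compl-dominated : ∀ {x} → x ∉ S → ¬ AdjacentToAll G S x →
                                   ∃ λ z → z ∈ S × compl G x z ≡ true
  ¬adjacentToAll⇒compl-dominated {S} {x} x∉S ¬all
    with ¬∀⟶∃¬ n _ (λ z → z ∈? S →-dec G x z Bool.≟ true) ¬all
  ... | z , ¬[z∈S→Gxz] with z ∈? S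
  ...   | no z∉S  = contradiction (λ z∈S → contradiction z∈S z∉S) ¬[z∈S→Gxz]
  ...   | yes z∈S = z , z∈S ,
    trans (compl-≢ (∉∧∈⇒≢ x∉S z∈S)) (cong not (¬-not (¬[z∈S→Gxz] ∘ const)))

  compl-dominated⇒¬adjacentToAll : ∀ {x z} → x ∉ S → z ∈ S → compl G x z ≡ true →
                                   ¬ AdjacentToAll G S x
  compl-dominated⇒¬adjacentToAll x∉S z∈S c all with
    trans (sym c) (trans (compl-≢ (∉∧∈⇒≢ x∉S z∈S)) (cong not (all _ z∈S)))
  ... | ()

  universal-unique : ∀ {x y} → Distinguishing G S → Universal G S x → Universal G S y → x ≡ y
  universal-unique {x = x} {y} dist (x∉S , x-all) (y∉S , y-all) with x ≟ y
  ... | yes x≡y = x≡y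
  ... | no x≢y  = contradiction (λ z z∈S → trans (x-all z z∈S) (sym (y-all z z∈S)))
                                (dist x y x∉S y∉S x≢y)

  noUniversal⇒LD-compl : Distinguishing G S → ¬ ∃ (Universal G S) →
                         LocatingDominating (compl G) S
  noUniversal⇒LD-compl {S} dist none =
    distinguishing-compl dist ,
    λ x x∉S → ¬adjacentToAll⇒compl-dominated x∉S (λ all → none (x , x∉S , all))

  universal⇒LD-compl-∪ : ∀ {x} → Distinguishing G S → Universal G S x →
                         LocatingDominating (compl G) (S ∪ ⁅ x ⁆)
  universal⇒LD-compl-∪ {S} {x} dist univ =
    distinguishing-compl (distinguishing-⊆ S⊆S∪x dist) , dominating
    where
    S⊆S∪x : S ⊆ S ∪ ⁅ x ⁆
    S⊆S∪x = p⊆p∪q ⁅ x ⁆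
    dominating : Dominating (compl G) (S ∪ ⁅ x ⁆)
    dominating y y∉ with adjacentToAll? S y
    ... | no ¬all = let z , z∈S , c = ¬adjacentToAll⇒compl-dominated (y∉ ∘ S⊆S∪x) ¬all
                    in z , S⊆S∪x z∈S , c
    ... | yes all = contradiction
      (x∈p∪q⁺ (inj₂ (subst (_∈ ⁅ x ⁆) (universal-unique dist univ (y∉ ∘ S⊆S∪x , all)) (x∈⁅x⁆ x))))
      y∉

  λ[Ḡ]≤1+λ[G] : IsLambda G a → IsLambda (compl G) b → b ≤ suc a
  λ[Ḡ]≤1+λ[G] ((S , (dist , _) , ∣S∣≡a) , _) (_ , minimal) with any? (universal? S)
  ... | yes (x , univ) = subst (_ ≤_) (trans (x∉p⇒∣p∪⁅x⁆∣≡1+∣p∣ (proj₁ univ)) (cong suc ∣S∣≡a))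
                                      (minimal _ (universal⇒LD-compl-∪ dist univ))
  ... | no none        =
    ℕ.m≤n⇒m≤1+n (subst (_ ≤_) ∣S∣≡a (minimal S (noUniversal⇒LD-compl dist none)))

  λ[Ḡ]≡1+λ[G]⇔universalUpTo : IsLambda G a → IsLambda (compl G) b →
                               (b ≡ suc a → UniversalUpTo G a) × (UniversalUpTo G a → b ≡ suc a)
  λ[Ḡ]≡1+λ[G]⇔universalUpTo {a} {b} λG λḠ@((T , (distT , domT) , ∣T∣≡b) , minimal) = ⇒ , ⇐
    where
    ⇒ : b ≡ suc a → UniversalUpTo G a
    ⇒ b≡1+a S dist ∣S∣≤a with any? (universal? S)
    ... | yes found = found
    ... | no none   = contradiction (ℕ.≤-trans (minimal S (noUniversal⇒LD-compl dist none)) ∣S∣≤a)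
                                    (ℕ.<⇒≱ (subst (a <_) (sym b≡1+a) ℕ.≤-refl))
    a<b : UniversalUpTo G a → a < b
    a<b univ = ℕ.≰⇒> λ b≤a →
      let x , x∉T , all = univ T (distinguishing-compl⁻ distT) (subst (_≤ a) (sym ∣T∣≡b) b≤a)
          z , z∈T , c   = domT x x∉T
      in compl-dominated⇒¬adjacentToAll x∉T z∈T c all
    ⇐ : UniversalUpTo G a → b ≡ suc a
    ⇐ univ = ℕ.≤-antisym (λ[Ḡ]≤1+λ[G] λG λḠ) (a<b univ)

AgreeOff : Adj n → Fin n → Fin n → Fin n → Set
AgreeOff {n} G u x y = ∀ (z : Fin n) → z ≢ u → G x z ≡ G y z

OffTwinFree : Adj n → Fin n → Subset n → Set
OffTwinFree {n} G u Z = ∀ (w w' : Fin n) → w ∈ Z → w' ∈ Z → w ≢ w' → ¬ AgreeOff G u w w'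

stable∧dominating⇒⊇ : ∀ {G : Adj n} {X S} → Stable G X → Dominating G S → S ⊆ X → X ⊆ S
stable∧dominating⇒⊇ {X = X} {S} stable dom S⊆X {t} t∈X with t ∈? S
... | yes t∈S = t∈S
... | no t∉S  = let z , z∈S , tz = dom t t∉S
                in contradiction (trans (sym tz) (stable t z t∈X (S⊆X z∈S))) λ ()

connected⇒∃nbr : ∀ {G : Adj n} {x y} → Connected G → x ≢ y → ∃ λ z → G x z ≡ true
connected⇒∃nbr {x = x} {y} conn x≢y with conn x y
... | here           = contradiction refl x≢y
... | step {y = z} xz _ = z , xz

module _ {n : ℕ} (G : Adj n) where

  private variable
    u : Fin n
    D : Subset n

  agreeOff-sym : AgreeOff G u x y → AgreeOff G u y x
  agreeOff-sym agree z z≢u = sym (agree z z≢u)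

  agreeOff-trans : ∀ {w} → AgreeOff G u x y → AgreeOff G u y w → AgreeOff G u x w
  agreeOff-trans xy yw z z≢u = trans (xy z z≢u) (yw z z≢u)

  agreeOff∧agreeAt⇒sameNbrs : AgreeOff G u x y → G x u ≡ G y u → ∀ z → G x z ≡ G y z
  agreeOff∧agreeAt⇒sameNbrs {u} agree at z with z ≟ u
  ... | yes refl = at
  ... | no z≢u   = agree z z≢u

  sameNbrs⇒twins : x ≢ y → (∀ z → G x z ≡ G y z) → Twins G x y
  sameNbrs⇒twins x≢y same = ∉⊥ , ∉⊥ , x≢y , inj₁ (λ z _ → same z)

  -- Only open twins can be non-adjacent: closed twins contain each other's neighbourhood.
  twinsIn⇒sameNbrs : G y x ≡ false → TwinsIn G D x y → ∀ z → z ∉ D → G x z ≡ G y z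
  twinsIn⇒sameNbrs _  (_ , _ , _ , inj₁ same) = same
  twinsIn⇒sameNbrs yx (x∉D , _ , x≢y , inj₂ closed) with proj₁ (closed _ x∉D) (inj₁ refl)
  ... | inj₁ x≡y = contradiction x≡y x≢y
  ... | inj₂ yx≡true = contradiction (trans (sym yx≡true) yx) λ ()

  twins⇒sameNbrs : G y x ≡ false → Twins G x y → ∀ z → G x z ≡ G y z
  twins⇒sameNbrs yx twins z = twinsIn⇒sameNbrs yx twins z ∉⊥

  twinsMinus⇒agreeOff : G y x ≡ false → TwinsMinus G u x y → AgreeOff G u x y
  twinsMinus⇒agreeOff yx twins z z≢u = twinsIn⇒sameNbrs yx twins z (x≢y⇒x∉⁅y⁆ z≢u)

  agreeOff⇒twinsMinus : x ≢ u → y ≢ u → x ≢ y → AgreeOff G u x y → TwinsMinus G u x y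
  agreeOff⇒twinsMinus x≢u y≢u x≢y agree =
    x≢y⇒x∉⁅y⁆ x≢u , x≢y⇒x∉⁅y⁆ y≢u , x≢y , inj₁ (λ z z∉u → agree z (x∉⁅y⁆⇒x≢y z∉u))

  agreeOff-twin⇒sameNbrs : (∀ a b → G a b ≡ G b a) → ∀ {u v x y} → v ≢ u →
                           (∀ z → G u z ≡ G v z) → AgreeOff G u x y → ∀ z → G x z ≡ G y z
  agreeOff-twin⇒sameNbrs symm {u} {v} {x} {y} v≢u twin agree =
    agreeOff∧agreeAt⇒sameNbrs agree (begin
      G x u   ≡⟨ symm x u ⟩
      G u x   ≡⟨ twin x ⟩
      G v x   ≡⟨ symm v x ⟩
      G x v   ≡⟨ agree v v≢u ⟩
      G y v   ≡⟨ symm y v ⟩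
      G v y   ≡⟨ twin y ⟨
      G u y   ≡⟨ symm u y ⟩
      G y u   ∎)
    where open ≡-Reasoning

module Bipartition {n : ℕ} (G : Adj n) (X Y : Subset n)
                   (X-stable : Stable G X) (Y-stable : Stable G Y) (∈Y⇒∉X : ∀ {v} → v ∈ Y → v ∉ X) (∉X⇒∈Y : ∀ {v} → v ∉ X → v ∈ Y) where

  Y-nonadj : y ∈ Y → x ∈ Y → G x y ≢ true
  Y-nonadj {y = y} {x} y∈Y x∈Y xy = contradiction (trans (sym xy) (Y-stable x y x∈Y y∈Y)) λ ()

  Y-nbr∈X : y ∈ Y → G y x ≡ true → x ∈ X
  Y-nbr∈X {x = x} y∈Y yx with x ∈? X
  ... | yes x∈X = x∈X
  ... | no x∉X  = contradiction yx (Y-nonadj (∉X⇒∈Y x∉X) y∈Y)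

  Y-adj∈X : y ∈ Y → G x y ≡ true → x ∈ X
  Y-adj∈X {x = x} y∈Y xy with x ∈? X
  ... | yes x∈X = x∈X
  ... | no x∉X  = contradiction xy (Y-nonadj y∈Y (∉X⇒∈Y x∉X))

  universal⇒⊆X : ∀ {S z} → Universal G S z → z ∈ Y → S ⊆ X
  universal⇒⊆X (_ , all) z∈Y t∈S = Y-nbr∈X z∈Y (all _ t∈S)

  dominating∧universal⇒≡X : ∀ {S z} → Dominating G S → Universal G S z → z ∈ Y → S ≡ X
  dominating∧universal⇒≡X dom univ z∈Y =
    ⊆-antisym (universal⇒⊆X univ z∈Y) (stable∧dominating⇒⊇ X-stable dom (universal⇒⊆X univ z∈Y))

  swap : Fin n → Fin n → Subset n
  swap x y = (X - x) ∪ ⁅ y ⁆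

  X-x⊆swap : X - x ⊆ swap x y
  X-x⊆swap = p⊆p∪q _

  y∈swap : y ∈ swap x y
  y∈swap {y = y} = x∈p∪q⁺ (inj₂ (x∈⁅x⁆ y))

  ∣swap∣≡∣X∣ : x ∈ X → y ∈ Y → ∣ swap x y ∣ ≡ ∣ X ∣
  ∣swap∣≡∣X∣ x∈X y∈Y =
    trans (x∉p⇒∣p∪⁅x⁆∣≡1+∣p∣ (∈Y⇒∉X y∈Y ∘ p─q⊆p X _)) (sym (x∈p⇒∣p∣≡1+∣p-x∣ x∈X))

  swap-noUniversal : ∀ {t v} → y ∈ Y → t ∈ X → t ≢ x → ¬ Universal G (swap x y) v
  swap-noUniversal {t = t} {v} y∈Y t∈X t≢x (_ , all) =
    contradiction (trans (sym (all t (X-x⊆swap (x∈p∧x≢y⇒x∈p-y t∈X t≢x))))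
                         (X-stable v t (Y-adj∈X y∈Y (all _ y∈swap)) t∈X))
                  λ ()

  outside-swap : ∀ {v} → v ∉ swap x y → v ≡ x ⊎ v ∈ Y - y
  outside-swap {x = x} {y} {v} v∉ with v ≟ x | v ∈? X
  ... | yes v≡x | _       = inj₁ v≡x
  ... | no v≢x  | yes v∈X = contradiction (X-x⊆swap (x∈p∧x≢y⇒x∈p-y v∈X v≢x)) v∉
  ... | no _    | no v∉X  = inj₂ (x∈p∧x≢y⇒x∈p-y (∉X⇒∈Y v∉X) λ { refl → v∉ y∈swap })

  sameTrace-swap⇒agreeOff : ∀ {w w'} → w ∈ Y → w' ∈ Y → SameTrace G (swap x y) w w' →
                            AgreeOff G x w w'
  sameTrace-swap⇒agreeOff {w = w} {w'} w∈Y w'∈Y same z z≢x with z ∈? X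
  ... | yes z∈X = same z (X-x⊆swap (x∈p∧x≢y⇒x∈p-y z∈X z≢x))
  ... | no z∉X  = trans (Y-stable w z w∈Y (∉X⇒∈Y z∉X)) (sym (Y-stable w' z w'∈Y (∉X⇒∈Y z∉X)))

  swap-distinguishing : x ∈ X → y ∈ Y → G x y ≡ true → OffTwinFree G x (Y - y) →
                        Distinguishing G (swap x y)
  swap-distinguishing {x} {y} x∈X y∈Y xy free v v' v∉ v'∉ v≢v' same
    with outside-swap v∉ | outside-swap v'∉
  ... | inj₁ refl | inj₁ refl = v≢v' refl
  ... | inj₁ refl | inj₂ v'∈  = Y-nonadj y∈Y (p─q⊆p Y _ v'∈) (trans (sym (same y y∈swap)) xy)
  ... | inj₂ v∈   | inj₁ refl = Y-nonadj y∈Y (p─q⊆p Y _ v∈) (trans (same y y∈swap) xy)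
  ... | inj₂ v∈   | inj₂ v'∈  = free v v' v∈ v'∈ v≢v'
    (sameTrace-swap⇒agreeOff (p─q⊆p Y _ v∈) (p─q⊆p Y _ v'∈) same)

  swap-refutes : UniversalUpTo G ∣ X ∣ → ∀ {t} → x ∈ X → y ∈ Y → G x y ≡ true → t ∈ X → t ≢ x →
                 ¬ OffTwinFree G x (Y - y)
  swap-refutes univ x∈X y∈Y xy t∈X t≢x free =
    let _ , universal = univ _ (swap-distinguishing x∈X y∈Y xy free)
                                 (ℕ.≤-reflexive (∣swap∣≡∣X∣ x∈X y∈Y))
    in swap-noUniversal y∈Y t∈X t≢x universal

module BipartiteGraph {n : ℕ} (G : Adj n) (U : Subset n) (simple : IsSimple G) (conn : Connected G)
                      (U-stable : Stable G U) (W-stable : Stable G (∁ U))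
                      (2≤∣U∣ : 2 ≤ ∣ U ∣) (∣U∣<∣W∣ : ∣ U ∣ < ∣ ∁ U ∣) where

  W : Subset n
  W = ∁ U

  symm : ∀ x y → G x y ≡ G y x
  symm = proj₁ simple

  module UW = Bipartition G U W U-stable W-stable x∈∁p⇒x∉p x∉p⇒x∈∁p
  module WU = Bipartition G W U W-stable U-stable x∈p⇒x∉∁p x∉∁p⇒x∈p

  W∧U⇒≢ : ∀ {x u} → x ∈ W → u ∈ U → x ≢ u
  W∧U⇒≢ x∈W u∈U refl = x∈∁p⇒x∉p x∈W u∈U

  W-sameTrace-U⇒sameNbrs : ∀ {x y} → x ∈ W → y ∈ W → SameTrace G U x y → ∀ z → G x z ≡ G y z
  W-sameTrace-U⇒sameNbrs {x} {y} x∈W y∈W same z with z ∈? U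
  ... | yes z∈U = same z z∈U
  ... | no z∉U  = trans (W-stable x z x∈W (x∉p⇒x∈∁p z∉U)) (sym (W-stable y z y∈W (x∉p⇒x∈∁p z∉U)))

  agreeOff-differAt : CondI G W → ∀ {u x y} → x ∈ W → y ∈ W → x ≢ y → AgreeOff G u x y →
                      G x u ≢ G y u
  agreeOff-differAt condI x∈W y∈W x≢y agree xu≡yu =
    condI _ _ x∈W y∈W (sameNbrs⇒twins G x≢y (agreeOff∧agreeAt⇒sameNbrs G agree xu≡yu))

  -- Two of the values G a u, G b u, G c u coincide, which by (i) is impossible.
  agreeOff-noTriangle : CondI G W → ∀ {u a b c} → a ∈ W → b ∈ W → c ∈ W → a ≢ b → a ≢ c → b ≢ c →
                        AgreeOff G u a b → AgreeOff G u a c → Empty.⊥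
  agreeOff-noTriangle condI a∈W b∈W c∈W a≢b a≢c b≢c ab ac =
    agreeOff-differAt condI b∈W c∈W b≢c (agreeOff-trans G (agreeOff-sym G ab) ac)
      (trans (¬-not (≢-sym (agreeOff-differAt condI a∈W b∈W a≢b ab)))
             (sym (¬-not (≢-sym (agreeOff-differAt condI a∈W c∈W a≢c ac)))))

  U-locatingDominating : CondI G W → LocatingDominating G U
  U-locatingDominating condI = distinguishing , dominating
    where
    distinguishing : Distinguishing G U
    distinguishing x y x∉U y∉U x≢y same = condI x y x∈W y∈W
      (sameNbrs⇒twins G x≢y (W-sameTrace-U⇒sameNbrs x∈W y∈W same))
      where
      x∈W = x∉p⇒x∈∁p x∉U
      y∈W = x∉p⇒x∈∁p y∉U
    dominating : Dominating G U
    dominating x x∉U =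
      let u , u∈U = ∣p∣>0⇒Nonempty {p = U} (ℕ.≤-trans (s≤s z≤n) 2≤∣U∣)
          z , xz  = connected⇒∃nbr {G = G} {y = u} conn λ { refl → x∉U u∈U }
      in z , UW.Y-nbr∈X (x∉p⇒x∈∁p x∉U) xz , xz

  OrderedOffTwins : Fin n → Fin n → Fin n → Set
  OrderedOffTwins u x y = x ∈ W × y ∈ W × x F.< y × AgreeOff G u x y

  orderedOffTwins? : ∀ u x y → Dec (OrderedOffTwins u x y)
  orderedOffTwins? u x y =
    x ∈? W ×-dec y ∈? W ×-dec x <? y ×-dec all? (λ z → ¬? (z ≟ u) →-dec G x z Bool.≟ G y z)

  orderedOffTwins⇒twinsMinus : ∀ {u x y} → u ∈ U → OrderedOffTwins u x y → TwinsMinus G u x y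
  orderedOffTwins⇒twinsMinus u∈U (x∈W , y∈W , x<y , agree) =
    agreeOff⇒twinsMinus G (W∧U⇒≢ x∈W u∈U) (W∧U⇒≢ y∈W u∈U) (F.<⇒≢ x<y) agree

  offTwinFree-if-onePerPair : ∀ {u e} → (∀ x y → OrderedOffTwins u x y → x ≡ e ⊎ y ≡ e) →
                              OffTwinFree G u (W - e)
  offTwinFree-if-onePerPair {u} {e} hits w w' w∈ w'∈ w≢w' agree with <-cmp w w'
  ... | tri≈ _ w≡w' _ = w≢w' w≡w'
  ... | tri< w<w' _ _ = [ x∈p-y⇒x≢y w∈ , x∈p-y⇒x≢y w'∈ ]′
                          (hits w w' (p─q⊆p W _ w∈ , p─q⊆p W _ w'∈ , w<w' , agree))
  ... | tri> _ _ w'<w = [ x∈p-y⇒x≢y w'∈ , x∈p-y⇒x≢y w∈ ]′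
                          (hits w' w (p─q⊆p W _ w'∈ , p─q⊆p W _ w∈ , w'<w , agreeOff-sym G agree))

  module Forward {a} (S₀ : Subset n) (dist₀ : Distinguishing G S₀) (dom₀ : Dominating G S₀)
                 (∣S₀∣≡a : ∣ S₀ ∣ ≡ a) (minimal : ∀ S → LocatingDominating G S → a ≤ ∣ S ∣)
                 (univ : UniversalUpTo G a) where

    z-universal : ∃ (Universal G S₀)
    z-universal = univ S₀ dist₀ (ℕ.≤-reflexive ∣S₀∣≡a)

    z : Fin n
    z = proj₁ z-universal

    z-univ : Universal G S₀ z
    z-univ = proj₂ z-universal

    univ-at : ∀ {X} → S₀ ≡ X → UniversalUpTo G ∣ X ∣
    univ-at refl = subst (UniversalUpTo G) (sym ∣S₀∣≡a) univ

    twin-∉S₀ : ∀ {e f} → e ∈ W → f ∈ W → f ≢ e → (∀ t → G e t ≡ G f t) → e ∉ S₀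
    twin-∉S₀ {e} {f} e∈W f∈W f≢e twin e∈S₀ =
      WU.swap-refutes (univ-at S₀≡W) e∈W z∈U (trans (symm e z) ze) f∈W f≢e offTwinFree
      where
      ze : G z e ≡ true
      ze = proj₂ z-univ e e∈S₀
      z∈U : z ∈ U
      z∈U = UW.Y-adj∈X e∈W ze
      S₀≡W : S₀ ≡ W
      S₀≡W = WU.dominating∧universal⇒≡X dom₀ z-univ z∈U
      U∉S₀ : ∀ {u} → u ∈ U → u ∉ S₀
      U∉S₀ {u} u∈U = subst (u ∉_) (sym S₀≡W) (x∈p⇒x∉∁p u∈U)
      -- e has the twin f, so vertices agreeing off e have the same trace on S₀.
      offTwinFree : OffTwinFree G e (U - z)
      offTwinFree u u' u∈ u'∈ u≢u' agree =
        dist₀ u u' (U∉S₀ (p─q⊆p U _ u∈)) (U∉S₀ (p─q⊆p U _ u'∈)) u≢u'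
          (λ t _ → agreeOff-twin⇒sameNbrs G symm f≢e twin agree t)

    sameNbrs-W⇒⊥ : ∀ {x y} → x ∈ W → y ∈ W → x ≢ y → (∀ t → G x t ≡ G y t) → Empty.⊥
    sameNbrs-W⇒⊥ {x} {y} x∈W y∈W x≢y same with x ∈? S₀ | y ∈? S₀
    ... | yes x∈S₀ | _        = twin-∉S₀ x∈W y∈W (≢-sym x≢y) same x∈S₀
    ... | no _     | yes y∈S₀ = twin-∉S₀ y∈W x∈W x≢y (sym ∘ same) y∈S₀
    ... | no x∉S₀  | no y∉S₀  = dist₀ x y x∉S₀ y∉S₀ x≢y (λ t _ → same t)

    condI : CondI G W
    condI x y x∈W y∈W twins =
      sameNbrs-W⇒⊥ x∈W y∈W (proj₁ (proj₂ (proj₂ twins)))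
                            (twins⇒sameNbrs G (W-stable y x y∈W x∈W) twins)

    z∈W : z ∈ W
    z∈W with z ∈? U
    ... | no z∉U  = x∉p⇒x∈∁p z∉U
    ... | yes z∈U = contradiction (subst (_≤ ∣ U ∣) a≡∣W∣ (minimal U (U-locatingDominating condI)))
                                  (ℕ.<⇒≱ ∣U∣<∣W∣)
      where
      a≡∣W∣ : a ≡ ∣ W ∣
      a≡∣W∣ = trans (sym ∣S₀∣≡a) (cong ∣_∣ (WU.dominating∧universal⇒≡X dom₀ z-univ z∈U))

    S₀≡U : S₀ ≡ U
    S₀≡U = UW.dominating∧universal⇒≡X dom₀ z-univ z∈W

    z-adj-U : ∀ {u} → u ∈ U → G z u ≡ true
    z-adj-U {u} u∈U = proj₂ z-univ u (subst (u ∈_) (sym S₀≡U) u∈U)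

    condII : CondII G U W
    condII = z , z∈W , λ u → UW.Y-nbr∈X z∈W , z-adj-U

    refutes-at : ∀ {u e} → u ∈ U → e ∈ W → G u e ≡ true → ¬ OffTwinFree G u (W - e)
    refutes-at u∈U e∈W ue =
      let t , t∈U , t≢u = x∈p⇒∃other 2≤∣U∣ u∈U
      in UW.swap-refutes (univ-at S₀≡U) u∈U e∈W ue t∈U t≢u

    adjacentEnd : ∀ {u x y} → OrderedOffTwins u x y →
                  ∃ λ e → (x ≡ e ⊎ y ≡ e) × e ∈ W × G u e ≡ true
    adjacentEnd {u} {x} {y} (x∈W , y∈W , x<y , agree) with G u x Bool.≟ true
    ... | yes ux = x , inj₁ refl , x∈W , ux
    ... | no ¬ux = y , inj₂ refl , y∈W , (begin
      G u y          ≡⟨ symm u y ⟩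
      G y u          ≡⟨ ¬-not (≢-sym (agreeOff-differAt condI x∈W y∈W (F.<⇒≢ x<y) agree)) ⟩
      not (G x u)    ≡⟨ cong not (symm x u) ⟩
      not (G u x)    ≡⟨ cong not (¬-not ¬ux) ⟩
      true           ∎)
      where open ≡-Reasoning

    condIII : CondIII G U W
    condIII u u∈U with any? (λ x → any? (orderedOffTwins? u x))
    ... | no none = ⊥-elim (refutes-at u∈U z∈W (trans (symm u z) (z-adj-U u∈U))
                              (offTwinFree-if-onePerPair λ x y p → ⊥-elim (none (x , y , p))))
    ... | yes (x , y , p@(x∈W , y∈W , x<y , _))
      with any? (λ x' → any? λ y' → orderedOffTwins? u x' y' ×-dec ¬? (x ≟ x' ×-dec y ≟ y'))
    ...   | yes (x' , y' , p'@(x'∈W , y'∈W , x'<y' , _) , ≢pair) =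
      x , y , x' , y' , x∈W , y∈W , x'∈W , y'∈W , x<y , x'<y' , ≢pair ,
      orderedOffTwins⇒twinsMinus u∈U p , orderedOffTwins⇒twinsMinus u∈U p'
    ...   | no unique =
      let e , ends , e∈W , ue = adjacentEnd p
      in ⊥-elim (refutes-at u∈U e∈W ue (offTwinFree-if-onePerPair (hits ends)))
      where
      hits : ∀ {e} → x ≡ e ⊎ y ≡ e → ∀ x' y' → OrderedOffTwins u x' y' → x' ≡ e ⊎ y' ≡ e
      hits ends x' y' p' with x ≟ x' ×-dec y ≟ y'
      ... | yes (refl , refl) = ends
      ... | no ≢pair          = ⊥-elim (unique (x' , y' , p' , ≢pair))

  module Backward (condI : CondI G W) (condIII : CondIII G U W) where

    AgreeOutside : Subset n → Fin n → Fin n → Set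
    AgreeOutside D x y = ∀ z → z ∈ U → z ∉ D → G x z ≡ G y z

    SeparatedOutside : Subset n → Subset n → Set
    SeparatedOutside D X = ∀ x y → x ∈ X → y ∈ X → x ≢ y → ¬ AgreeOutside D x y

    agreeOutside? : ∀ D x y → Dec (AgreeOutside D x y)
    agreeOutside? D x y = all? λ z → z ∈? U →-dec ¬? (z ∈? D) →-dec G x z Bool.≟ G y z

    agreeOutside-⊆ : ∀ {D D' x y} → D' ⊆ D → AgreeOutside D' x y → AgreeOutside D x y
    agreeOutside-⊆ D'⊆D agree z z∈U z∉D = agree z z∈U (z∉D ∘ D'⊆D)

    agreeOff⇒agreeOutside : ∀ {D u x y} → u ∈ D → AgreeOff G u x y → AgreeOutside D x y
    agreeOff⇒agreeOutside {D} u∈D agree z _ z∉D = agree z λ { refl → z∉D u∈D }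

    separatedOutside-⊆ : ∀ {D D' X} → D' ⊆ D → SeparatedOutside D X → SeparatedOutside D' X
    separatedOutside-⊆ D'⊆D sep x y x∈X y∈X x≢y = sep x y x∈X y∈X x≢y ∘ agreeOutside-⊆ D'⊆D

    separatedOutside-∪ : ∀ {D X e} → SeparatedOutside D X → (∀ c → c ∈ X → ¬ AgreeOutside D c e) →
                         SeparatedOutside D (X ∪ ⁅ e ⁆)
    separatedOutside-∪ {D} {X} {e} sep fresh x y x∈ y∈ x≢y agree
      with x∈p∪q⁻ X ⁅ e ⁆ x∈ | x∈p∪q⁻ X ⁅ e ⁆ y∈
    ... | inj₁ x∈X | inj₁ y∈X = sep x y x∈X y∈X x≢y agree
    ... | inj₁ x∈X | inj₂ y∈e rewrite x∈⁅y⁆⇒x≡y e y∈e = fresh x x∈X agree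
    ... | inj₂ x∈e | inj₁ y∈X rewrite x∈⁅y⁆⇒x≡y e x∈e =
      fresh y y∈X (λ z z∈U z∉D → sym (agree z z∈U z∉D))
    ... | inj₂ x∈e | inj₂ y∈e = x≢y (trans (x∈⁅y⁆⇒x≡y e x∈e) (sym (x∈⁅y⁆⇒x≡y e y∈e)))

    agreeOutside⇒sameTrace : ∀ {D S x y} → x ∈ W → y ∈ W → (∀ {z} → z ∈ S → z ∉ D) →
                             AgreeOutside D x y → SameTrace G S x y
    agreeOutside⇒sameTrace {x = x} {y} x∈W y∈W S∩D≡∅ agree z z∈S with z ∈? U
    ... | yes z∈U = agree z z∈U (S∩D≡∅ z∈S)
    ... | no z∉U  = trans (W-stable x z x∈W (x∉p⇒x∈∁p z∉U)) (sym (W-stable y z y∈W (x∉p⇒x∈∁p z∉U)))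

    TwoOffTwinPairs : Fin n → Set
    TwoOffTwinPairs u = Σ (Fin n) λ x → Σ (Fin n) λ y → Σ (Fin n) λ x' → Σ (Fin n) λ y' →
      OrderedOffTwins u x y × OrderedOffTwins u x' y' × ¬ (x ≡ x' × y ≡ y')

    twoOffTwinPairs : ∀ {u} → u ∈ U → TwoOffTwinPairs u
    twoOffTwinPairs u∈U with condIII _ u∈U
    ... | x , y , x' , y' , x∈W , y∈W , x'∈W , y'∈W , x<y , x'<y' , ≢pair , twins , twins' =
      x , y , x' , y' ,
      (x∈W , y∈W , x<y , twinsMinus⇒agreeOff G (W-stable y x y∈W x∈W) twins) ,
      (x'∈W , y'∈W , x'<y' , twinsMinus⇒agreeOff G (W-stable y' x' y'∈W x'∈W) twins') , ≢pair

    pairMember∉ : ∀ {D X u x y} → u ∈ D → SeparatedOutside D X → x ∈ W → y ∈ W → x ≢ y →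
                  AgreeOff G u x y → ∃ λ e → (x ≡ e ⊎ y ≡ e) × e ∈ W × e ∉ X
    pairMember∉ {X = X} {x = x} {y} u∈D sep x∈W y∈W x≢y agree with x ∈? X
    ... | no x∉X  = x , inj₁ refl , x∈W , x∉X
    ... | yes x∈X =
      y , inj₂ refl , y∈W , λ y∈X → sep x y x∈X y∈X x≢y (agreeOff⇒agreeOutside u∈D agree)

    sharedEnd⇒samePair : ∀ {u x y x' y' e} → OrderedOffTwins u x y → OrderedOffTwins u x' y' →
                         x ≡ e ⊎ y ≡ e → x' ≡ e ⊎ y' ≡ e → x ≡ x' × y ≡ y'
    sharedEnd⇒samePair {y = y} {y' = y'}
      (x∈W , y∈W , x<y , xy) (_ , y'∈W , x'<y' , x'y') (inj₁ refl) (inj₁ refl) with y ≟ y'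
    ... | yes y≡y' = refl , y≡y'
    ... | no y≢y'  = ⊥-elim (agreeOff-noTriangle condI x∈W y∈W y'∈W
                               (F.<⇒≢ x<y) (F.<⇒≢ x'<y') y≢y' xy x'y')
    sharedEnd⇒samePair {y = y} {x' = x'}
      (x∈W , y∈W , x<y , xy) (x'∈W , _ , x'<y' , x'y') (inj₁ refl) (inj₂ refl) with y ≟ x'
    ... | yes refl = ⊥-elim (F.<-asym x<y x'<y')
    ... | no y≢x'  = ⊥-elim (agreeOff-noTriangle condI x∈W y∈W x'∈W
                               (F.<⇒≢ x<y) (≢-sym (F.<⇒≢ x'<y')) y≢x' xy (agreeOff-sym G x'y'))
    sharedEnd⇒samePair {x = x} {y' = y'}
      (x∈W , y∈W , x<y , xy) (_ , y'∈W , x'<y' , x'y') (inj₂ refl) (inj₁ refl) with x ≟ y'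
    ... | yes refl = ⊥-elim (F.<-asym x<y x'<y')
    ... | no x≢y'  = ⊥-elim (agreeOff-noTriangle condI y∈W x∈W y'∈W
                               (≢-sym (F.<⇒≢ x<y)) (F.<⇒≢ x'<y') x≢y' (agreeOff-sym G xy) x'y')
    sharedEnd⇒samePair {x = x} {x' = x'}
      (x∈W , y∈W , x<y , xy) (x'∈W , _ , x'<y' , x'y') (inj₂ refl) (inj₂ refl) with x ≟ x'
    ... | yes x≡x' = x≡x' , refl
    ... | no x≢x'  = ⊥-elim (agreeOff-noTriangle condI y∈W x∈W x'∈W
                               (≢-sym (F.<⇒≢ x<y)) (≢-sym (F.<⇒≢ x'<y')) x≢x'
                               (agreeOff-sym G xy) (agreeOff-sym G x'y'))

    -- Each of the two twin pairs of G - u offers a vertex outside X, and they are different.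
    separated⇒2+∣X∣≤∣W∣ : ∀ {D X u} → u ∈ D → u ∈ U → X ⊆ W → SeparatedOutside D X →
                          2 + ∣ X ∣ ≤ ∣ W ∣
    separated⇒2+∣X∣≤∣W∣ {X = X} u∈D u∈U X⊆W sep
      with twoOffTwinPairs u∈U
    ... | x , y , x' , y' , p@(x∈W , y∈W , x<y , agree) , p'@(x'∈W , y'∈W , x'<y' , agree') , ≢pair
      with pairMember∉ u∈D sep x∈W y∈W (F.<⇒≢ x<y) agree
         | pairMember∉ u∈D sep x'∈W y'∈W (F.<⇒≢ x'<y') agree'
    ... | e , ends , e∈W , e∉X | e' , ends' , e'∈W , e'∉X = begin
      2 + ∣ X ∣                  ≡⟨ cong suc (x∉p⇒∣p∪⁅x⁆∣≡1+∣p∣ e∉X) ⟨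
      suc ∣ X ∪ ⁅ e ⁆ ∣          ≡⟨ x∉p⇒∣p∪⁅x⁆∣≡1+∣p∣ e'∉X∪e ⟨
      ∣ (X ∪ ⁅ e ⁆) ∪ ⁅ e' ⁆ ∣   ≤⟨ p⊆q⇒∣p∣≤∣q∣ (p⊆r∧x∈r⇒p∪⁅x⁆⊆r (p⊆r∧x∈r⇒p∪⁅x⁆⊆r X⊆W e∈W) e'∈W) ⟩
      ∣ W ∣                      ∎
      where
      open ℕ.≤-Reasoning
      e'∉X∪e : e' ∉ X ∪ ⁅ e ⁆
      e'∉X∪e e'∈ with x∈p∪q⁻ X ⁅ e ⁆ e'∈
      ... | inj₁ e'∈X = e'∉X e'∈X
      ... | inj₂ e'∈e rewrite x∈⁅y⁆⇒x≡y e e'∈e = ≢pair (sharedEnd⇒samePair p p' ends ends')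

    differsAt⇒fresh : ∀ {D X v c x e} → v ∈ U → SeparatedOutside D X → c ∈ X →
                      AgreeOutside D c x → AgreeOutside D e x → G c v ≢ G e v →
                      ∀ c' → c' ∈ X → ¬ AgreeOutside (D - v) c' e
    differsAt⇒fresh {D} {v = v} {c} v∈U sep c∈X c~x e~x cv≢ev c' c'∈X c'~e with c' ≟ c
    ... | yes refl = cv≢ev (c'~e v v∈U λ v∈D-v → x∈p-y⇒x≢y v∈D-v refl)
    ... | no c'≢c  = sep c' c c'∈X c∈X c'≢c λ z z∈U z∉D →
      trans (agreeOutside-⊆ (p─q⊆p D _) c'~e z z∈U z∉D)
            (trans (e~x z z∈U z∉D) (sym (c~x z z∈U z∉D)))

    -- The twins x, y of G - v differ at v, so a vertex of X can match at most one of them there.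
    freshVertex : ∀ {D X v} → v ∈ D → v ∈ U → SeparatedOutside D X →
                  ∃ λ e → e ∈ W × (∀ c → c ∈ X → ¬ AgreeOutside (D - v) c e)
    freshVertex {D} {X} {v} v∈D v∈U sep with twoOffTwinPairs v∈U
    ... | x , y , _ , _ , (x∈W , y∈W , x<y , agree) , _
      with any? (λ c → c ∈? X ×-dec agreeOutside? D c x)
    ...   | no none = x , x∈W , λ c c∈X c~x → none (c , c∈X , agreeOutside-⊆ (p─q⊆p D _) c~x)
    ...   | yes (c , c∈X , c~x) with G c v Bool.≟ G x v
    ...     | no cv≢xv  = x , x∈W , differsAt⇒fresh v∈U sep c∈X c~x (λ _ _ _ → refl) cv≢xv
    ...     | yes cv≡xv = y , y∈W ,
      differsAt⇒fresh v∈U sep c∈X c~x (agreeOff⇒agreeOutside v∈D (agreeOff-sym G agree))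
        (λ cv≡yv → agreeOff-differAt condI x∈W y∈W (F.<⇒≢ x<y) agree (trans (sym cv≡xv) cv≡yv))

    separated-bound : ∀ m {D X} → ∣ D ∣ ≡ suc m → D ⊆ U → X ⊆ W → SeparatedOutside D X →
                      ∣ X ∣ + ∣ D ∣ < ∣ W ∣
    separated-bound zero {D} {X} ∣D∣≡1 D⊆U X⊆W sep =
      let u , u∈D = ∣p∣>0⇒Nonempty {p = D} (subst (0 <_) (sym ∣D∣≡1) (s≤s z≤n))
      in subst (λ k → suc (∣ X ∣ + k) ≤ ∣ W ∣) (sym ∣D∣≡1)
               (subst (_≤ ∣ W ∣) (cong suc (ℕ.+-comm 1 ∣ X ∣))
                      (separated⇒2+∣X∣≤∣W∣ u∈D (D⊆U u∈D) X⊆W sep))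
    separated-bound (suc m) {D} {X} ∣D∣≡2+m D⊆U X⊆W sep = begin-strict
      ∣ X ∣ + ∣ D ∣                ≡⟨ cong (∣ X ∣ +_) (x∈p⇒∣p∣≡1+∣p-x∣ v∈D) ⟩
      ∣ X ∣ + suc ∣ D - v ∣        ≡⟨ ℕ.+-suc ∣ X ∣ _ ⟩
      suc ∣ X ∣ + ∣ D - v ∣        ≡⟨ cong (_+ ∣ D - v ∣) (x∉p⇒∣p∪⁅x⁆∣≡1+∣p∣ e∉X) ⟨
      ∣ X ∪ ⁅ e ⁆ ∣ + ∣ D - v ∣    <⟨ separated-bound m ∣D-v∣≡1+m
                                        (D⊆U ∘ p─q⊆p D _) (p⊆r∧x∈r⇒p∪⁅x⁆⊆r X⊆W e∈W)
                                        (separatedOutside-∪ (separatedOutside-⊆ (p─q⊆p D _) sep) fresh) ⟩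
      ∣ W ∣                        ∎
      where
      open ℕ.≤-Reasoning
      v-in-D : Nonempty D
      v-in-D = ∣p∣>0⇒Nonempty (subst (0 <_) (sym ∣D∣≡2+m) (s≤s z≤n))
      v = proj₁ v-in-D
      v∈D = proj₂ v-in-D
      ∣D-v∣≡1+m : ∣ D - v ∣ ≡ suc m
      ∣D-v∣≡1+m = ℕ.suc-injective (trans (sym (x∈p⇒∣p∣≡1+∣p-x∣ v∈D)) ∣D∣≡2+m)
      e-fresh = freshVertex v∈D (D⊆U v∈D) sep
      e = proj₁ e-fresh
      e∈W = proj₁ (proj₂ e-fresh)
      fresh = proj₂ (proj₂ e-fresh)
      e∉X : e ∉ X
      e∉X e∈X = fresh e e∈X λ _ _ _ → refl

    -- With K = U ∖ S and X = W ∖ S, the bound |X| + |K| < |W| says that S contains more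
    -- vertices of W than it misses in U, so |S| > |U|.
    U⊆smallDistinguishing : ∀ {S} → Distinguishing G S → ∣ S ∣ ≤ ∣ U ∣ → U ⊆ S
    U⊆smallDistinguishing {S} dist ∣S∣≤∣U∣ {u} u∈U with u ∈? S
    ... | yes u∈S = u∈S
    ... | no u∉S  = contradiction ∣W∩S∣≤∣K∣ (ℕ.<⇒≱ ∣K∣<∣W∩S∣)
      where
      K X : Subset n
      K = U ∩ ∁ S
      X = W ∩ ∁ S
      u∈K : u ∈ K
      u∈K = x∈p∩q⁺ (u∈U , x∉p⇒x∈∁p u∉S)
      ∁S∌ : ∀ {p z} → z ∈ p ∩ ∁ S → z ∉ S
      ∁S∌ {p} z∈ = x∈∁p⇒x∉p (proj₂ (x∈p∩q⁻ p _ z∈))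
      separated : SeparatedOutside K X
      separated x y x∈X y∈X x≢y agree =
        dist x y (∁S∌ x∈X) (∁S∌ y∈X) x≢y
          (agreeOutside⇒sameTrace (p∩q⊆p W _ x∈X) (p∩q⊆p W _ y∈X) (λ z∈S z∈K → ∁S∌ z∈K z∈S) agree)
      ∣U∣≡ : ∣ U ∣ ≡ ∣ U ∩ S ∣ + ∣ K ∣
      ∣U∣≡ = ∣p∣≡∣p∩q∣+∣p∩∁q∣ U S
      ∣W∣≡ : ∣ W ∣ ≡ ∣ W ∩ S ∣ + ∣ X ∣
      ∣W∣≡ = ∣p∣≡∣p∩q∣+∣p∩∁q∣ W S
      ∣S∣≡ : ∣ S ∣ ≡ ∣ U ∩ S ∣ + ∣ W ∩ S ∣
      ∣S∣≡ = trans (∣p∣≡∣p∩q∣+∣p∩∁q∣ S U)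
                   (cong₂ _+_ (cong ∣_∣ (∩-comm S U)) (cong ∣_∣ (∩-comm S W)))
      ∣W∩S∣≤∣K∣ : ∣ W ∩ S ∣ ≤ ∣ K ∣
      ∣W∩S∣≤∣K∣ = ℕ.+-cancelˡ-≤ ∣ U ∩ S ∣ _ _ (subst₂ _≤_ ∣S∣≡ ∣U∣≡ ∣S∣≤∣U∣)
      ∣K∣<∣W∩S∣ : ∣ K ∣ < ∣ W ∩ S ∣
      ∣K∣<∣W∩S∣ = ℕ.+-cancelˡ-< ∣ X ∣ _ _ (subst₂ _<_ refl (trans ∣W∣≡ (ℕ.+-comm _ ∣ X ∣))
        (separated-bound _ (x∈p⇒∣p∣≡1+∣p-x∣ u∈K) (p∩q⊆p U _) (p∩q⊆p W _) separated))

    universalUpTo : CondII G U W → ∀ {a} → a ≤ ∣ U ∣ → UniversalUpTo G a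
    universalUpTo (w , w∈W , w-nbrs) a≤∣U∣ S dist ∣S∣≤a =
      w , x∈∁p⇒x∉p w∈W ∘ S⊆U , λ t t∈S → proj₂ (w-nbrs t) (S⊆U t∈S)
      where
      ∣S∣≤∣U∣ : ∣ S ∣ ≤ ∣ U ∣
      ∣S∣≤∣U∣ = ℕ.≤-trans ∣S∣≤a a≤∣U∣
      S⊆U : S ⊆ U
      S⊆U {t} t∈S with t ∈? U
      ... | yes t∈U = t∈U
      ... | no t∉U  =
        contradiction (p⊂q⇒∣p∣<∣q∣ (U⊆smallDistinguishing dist ∣S∣≤∣U∣ , t , t∈S , t∉U))
                      (ℕ.≤⇒≯ ∣S∣≤∣U∣)

  Conditions : Set
  Conditions = CondI G W × CondII G U W × CondIII G U W

  universalUpTo⇔conditions : ∀ {a} → IsLambda G a →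
                             (UniversalUpTo G a → Conditions) × (Conditions → UniversalUpTo G a)
  universalUpTo⇔conditions ((S₀ , (dist₀ , dom₀) , ∣S₀∣≡a) , minimal) =
    (λ univ → let open Forward S₀ dist₀ dom₀ ∣S₀∣≡a minimal univ in condI , condII , condIII) ,
    (λ (condI , condII , condIII) →
      Backward.universalUpTo condI condIII condII (minimal U (U-locatingDominating condI)))

theorem18 : (n : ℕ) (G : Adj n) (U : Subset n) (r s : ℕ) →
    IsSimple G → Connected G →
    Stable G U → Stable G (∁ U) →
    ∣ U ∣ ≡ r → ∣ ∁ U ∣ ≡ s → n ≡ r + s → 4 ≤ n → 3 ≤ r → r < s →
    (a b : ℕ) → IsLambda G a → IsLambda (compl G) b →
    (b ≡ suc a → CondI G (∁ U) × CondII G U (∁ U) × CondIII G U (∁ U))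
    × (CondI G (∁ U) × CondII G U (∁ U) × CondIII G U (∁ U) → b ≡ suc a)
theorem18 _ G U _ _ simple conn U-stable W-stable refl refl _ _ 3≤∣U∣ ∣U∣<∣W∣ _ _ λG λḠ =
  ⇒conditions ∘ ⇒universal , ⇐universal ∘ ⇐conditions
  where
  open BipartiteGraph G U simple conn U-stable W-stable (ℕ.≤-trans (ℕ.n≤1+n 2) 3≤∣U∣) ∣U∣<∣W∣
  ⇒universal  = proj₁ (λ[Ḡ]≡1+λ[G]⇔universalUpTo G λG λḠ)
  ⇐universal  = proj₂ (λ[Ḡ]≡1+λ[G]⇔universalUpTo G λG λḠ)
  ⇒conditions = proj₁ (universalUpTo⇔conditions λG)
  ⇐conditions = proj₂ (universalUpTo⇔conditions λG)
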